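{- Let $n$ be a non-negative integer and let $A=\{(i_0,j_0),(i_1,j_1),\ldots,(i_{n-1},j_{n-1})\}$ be an $n$-element subset of $T_n=\{(i,j)\in\mathbb{N}^2 : i+j<n\}$. Then $A$ is a generating index set of $\mathrm{ST}_n$ if and only if the $n\times n$ matrix $$ M_A=\left(\binom{i_k}{\ell-j_k}\right)_{0\le k,\ell\le n-1} $$ is invertible modulo $2$.
   Context: $\mathbb{N}$ denotes the set of non-negative integers. A binary Steinhaus triangle of size $n$ is a family $(a_{i,j})_{(i,j)\in T_n}$ of elements of $\mathbb{Z}_2=\{0,1\}$ such that $a_{i,j}\equiv a_{i-1,j}+a_{i-1,j+1}\pmod 2$ for all $(i,j)\in T_n$ with $i\ge1$. The set $\mathrm{ST}_n$ of binary Steinhaus triangles of size $n$ is a vector space over $\mathbb{Z}/2\mathbb{Z}$ (entrywise addition mod 2) of dimension $n$. A subset $A\subseteq T_n$ is a generating index set of $\mathrm{ST}_n$ if the linear map $\pi_A:\mathrm{ST}_n\to\mathbb{Z}_2^{|A|}$, $(a_{i,j})_{(i,j)\in T_n}\mapsto (a_{i,j})_{(i,j)\in A}$, is an isomorphism. Binomial coefficients are extended by $\binom{a}{b}=0$ whenever $b<0$ or $b>a$. -}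

module Defs where

open import Data.Nat using (ℕ; zero; suc; _+_; _∸_; _<_; _<ᵇ_; _%_; _≡ᵇ_)
open import Data.Nat.Combinatorics using (_C_)
open import Data.Bool using (Bool; true; false; _xor_; _∧_; if_then_else_)
open import Data.Fin using (Fin; zero; suc; _≟_)
open import Data.Product using (_×_; _,_; Σ; ∃; proj₁; proj₂)
open import Relation.Nullary using (does)
open import Relation.Binary.PropositionalEquality using (_≡_)

InT : ℕ → ℕ × ℕ → Set
InT n (i , j) = i + j < n

-- A binary Steinhaus triangle of size n: a family of bits; only the
-- entries indexed by T_n are meaningful (entries outside T_n are ignored,
-- equality of triangles is equality on T_n, see _≈ST_ below).
record Steinhaus (n : ℕ) : Set where
  field
    entry : ℕ → ℕ → Bool
    rule  : ∀ i j → suc i + j < n →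
            entry (suc i) j ≡ (entry i j xor entry i (suc j))
open Steinhaus public

_≈ST_ : ∀ {n} → Steinhaus n → Steinhaus n → Set
_≈ST_ {n} s t = ∀ i j → i + j < n → entry s i j ≡ entry t i j

π : ∀ {n} → (Fin n → ℕ × ℕ) → Steinhaus n → (Fin n → Bool)
π A t k = entry t (proj₁ (A k)) (proj₂ (A k))

-- A is a generating index set of ST_n iff π_A is an isomorphism.
-- π_A is always linear, so this means π_A is bijective:
-- injective (up to equality of triangles) and surjective.
IsGeneratingIndexSet : (n : ℕ) → (Fin n → ℕ × ℕ) → Set
IsGeneratingIndexSet n A =
  (∀ (s t : Steinhaus n) → (∀ k → π A s k ≡ π A t k) → s ≈ST t)
  × (∀ (v : Fin n → Bool) → Σ (Steinhaus n) λ t → ∀ k → π A t k ≡ v k)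

-- Square matrices over Z_2 = Bool (xor = addition, ∧ = multiplication)
Mat : ℕ → Set
Mat n = Fin n → Fin n → Bool

sumZ2 : ∀ {n} → (Fin n → Bool) → Bool
sumZ2 {zero}  f = false
sumZ2 {suc n} f = f zero xor sumZ2 (λ i → f (suc i))

_⊗_ : ∀ {n} → Mat n → Mat n → Mat n
(M ⊗ N) i j = sumZ2 (λ k → M i k ∧ N k j)

idMat : ∀ {n} → Mat n
idMat i j = does (i ≟ j)

InvertibleZ2 : ∀ {n} → Mat n → Set
InvertibleZ2 {n} M = Σ (Mat n) λ N → (∀ i j → (M ⊗ N) i j ≡ idMat i j)
                                   × (∀ i j → (N ⊗ M) i j ≡ idMat i j)

-- Binomial coefficient (a choose (ℓ - j)) mod 2, with ℓ - j an integer
-- and the convention (a choose b) = 0 for b < 0 or b > a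
-- (the latter is built into Data.Nat.Combinatorics._C_).
binomMod2 : ℕ → ℕ → ℕ → Bool
binomMod2 a ℓ j = if ℓ <ᵇ j then false else ((a C (ℓ ∸ j)) % 2 ≡ᵇ 1)

M_ : ∀ {n} → (Fin n → ℕ × ℕ) → Mat n
M_ A k ℓ = binomMod2 (proj₁ (A k)) (Data.Fin.toℕ ℓ) (proj₂ (A k))

{-# OPTIONS --safe #-}
module Submission where

-- Every entry of a Steinhaus triangle is a binomial combination of its
-- first row: a(i,j) = Σ_ℓ C(i, ℓ - j) a(0,ℓ) mod 2, by Pascal's rule.
-- Since every first row extends to a unique triangle, reading off the first
-- row is a bijection ST_n ≅ Z₂ⁿ, and under it π_A becomes multiplication
-- by M_A.  So π_A is bijective iff M_A is, and a square matrix over Z₂ acts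
-- bijectively iff it is invertible: a right inverse is built column by
-- column from surjectivity, and injectivity shows it is also a left inverse.

open import Defs
open import Data.Nat using (ℕ)
open import Data.Fin using (Fin)
open import Data.Product using (_×_)
open import Function.Definitions using (Injective)
open import Function.Bundles using (_⇔_)
open import Relation.Binary.PropositionalEquality using (_≡_)

open import Algebra.Bundles using (CommutativeRing)
open import Data.Bool using (Bool; false; _xor_; _∧_)
open import Data.Bool.Properties
  using (xor-∧-commutativeRing; xor-comm; xor-identityʳ;
         ∧-assoc; ∧-comm; ∧-distribʳ-xor)
open import Data.Fin using (zero; suc; toℕ)
open import Data.Fin.Properties using (toℕ<n)
open import Data.Nat using (zero; suc; _+_; _<_; _%_; _≡ᵇ_; s≤s)
open import Data.Nat.Combinatorics using (_C_; nCk+nC[k+1]≡[n+1]C[k+1])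
open import Data.Nat.DivMod using (%-distribˡ-+; m%n<n)
open import Data.Nat.Properties using (n<1+n; <-trans; +-suc)
open import Data.Product using (Σ; _,_; proj₁; proj₂)
open import Data.Vec.Functional using (Vector)
open import Function.Bundles using (mk⇔)
open import Function.Construct.Composition using (_⇔-∘_)
open import Function.Construct.Symmetry using (⇔-sym)
open import Function.Definitions using (StrictlySurjective)
open import Relation.Binary.PropositionalEquality
  using (_≗_; refl; sym; trans; cong; cong₂; subst; module ≡-Reasoning)

open CommutativeRing xor-∧-commutativeRing using (semiring)
open import Algebra.Properties.Semiring.Sum semiring
  using (sum; sum-cong-≗; sum-replicate-zero; ∑-distrib-+; ∑-comm;
         *-distribˡ-sum; *-distribʳ-sum)
open ≡-Reasoning

isOdd : ℕ → Bool
isOdd m = m % 2 ≡ᵇ 1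

isOdd-+ : ∀ m n → isOdd (m + n) ≡ isOdd m xor isOdd n
isOdd-+ m n =
  trans (cong (_≡ᵇ 1) (%-distribˡ-+ m n 2)) (bits (m%n<n m 2) (m%n<n n 2))
  where
  bits : ∀ {a b} → a < 2 → b < 2 → isOdd (a + b) ≡ (a ≡ᵇ 1) xor (b ≡ᵇ 1)
  bits {0} {0} _ _ = refl
  bits {0} {1} _ _ = refl
  bits {1} {0} _ _ = refl
  bits {1} {1} _ _ = refl
  bits {suc (suc _)} (s≤s (s≤s ())) _
  bits {_} {suc (suc _)} _ (s≤s (s≤s ()))

binomMod2-pascal : ∀ a ℓ j →
  binomMod2 (suc a) ℓ j ≡ binomMod2 a ℓ j xor binomMod2 a ℓ (suc j)
binomMod2-pascal a zero    zero    = refl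
binomMod2-pascal a zero    (suc j) = refl
binomMod2-pascal a (suc ℓ) (suc j) = binomMod2-pascal a ℓ j
binomMod2-pascal a (suc m) zero    = begin
  isOdd (suc a C suc m)                ≡⟨ cong isOdd (nCk+nC[k+1]≡[n+1]C[k+1] a m) ⟨
  isOdd (a C m + a C suc m)            ≡⟨ isOdd-+ (a C m) (a C suc m) ⟩
  isOdd (a C m) xor isOdd (a C suc m)  ≡⟨ xor-comm (isOdd (a C m)) _ ⟩
  isOdd (a C suc m) xor isOdd (a C m)  ∎

sumZ2≡sum : ∀ {n} (f : Vector Bool n) → sumZ2 f ≡ sum f
sumZ2≡sum {zero}  f = refl
sumZ2≡sum {suc n} f = cong (f zero xor_) (sumZ2≡sum (λ i → f (suc i)))

infixr 7 _*ᵥ_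

_*ᵥ_ : ∀ {n} → Mat n → Vector Bool n → Vector Bool n
(P *ᵥ x) i = sum λ k → P i k ∧ x k

column : ∀ {n} → Mat n → Fin n → Vector Bool n
column P j i = P i j

*ᵥ-congˡ : ∀ {n} (P : Mat n) {x y : Vector Bool n} → x ≗ y → P *ᵥ x ≗ P *ᵥ y
*ᵥ-congˡ P x≗y i = sum-cong-≗ λ k → cong (P i k ∧_) (x≗y k)

*ᵥ-congʳ : ∀ {n} {P Q : Mat n} → (∀ i j → P i j ≡ Q i j) →
           ∀ x → P *ᵥ x ≗ Q *ᵥ x
*ᵥ-congʳ P≡Q x i = sum-cong-≗ λ k → cong (_∧ x k) (P≡Q i k)

column-⊗ : ∀ {n} (P Q : Mat n) j → column (P ⊗ Q) j ≗ P *ᵥ column Q j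
column-⊗ P Q j i = sumZ2≡sum (λ k → P i k ∧ Q k j)

⊗-*ᵥ : ∀ {n} (P Q : Mat n) x → (P ⊗ Q) *ᵥ x ≗ P *ᵥ Q *ᵥ x
⊗-*ᵥ P Q x i = begin
  (sum λ k → (P ⊗ Q) i k ∧ x k)
    ≡⟨ sum-cong-≗ (λ k → cong (_∧ x k) (column-⊗ P Q k i)) ⟩
  (sum λ k → (sum λ l → P i l ∧ Q l k) ∧ x k)
    ≡⟨ sum-cong-≗ (λ k → *-distribʳ-sum (x k) (λ l → P i l ∧ Q l k)) ⟩
  (sum λ k → sum λ l → (P i l ∧ Q l k) ∧ x k)
    ≡⟨ ∑-comm (λ k l → (P i l ∧ Q l k) ∧ x k) ⟩
  (sum λ l → sum λ k → (P i l ∧ Q l k) ∧ x k)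
    ≡⟨ sum-cong-≗ (λ l → sum-cong-≗ λ k → ∧-assoc (P i l) (Q l k) (x k)) ⟩
  (sum λ l → sum λ k → P i l ∧ (Q l k ∧ x k))
    ≡⟨ sum-cong-≗ (λ l → *-distribˡ-sum (P i l) (λ k → Q l k ∧ x k)) ⟨
  (sum λ l → P i l ∧ (Q *ᵥ x) l)
    ∎

idMat-*ᵥ : ∀ {n} (x : Vector Bool n) → idMat *ᵥ x ≗ x
idMat-*ᵥ {suc n} x zero    =
  trans (cong (x zero xor_) (sum-replicate-zero n)) (xor-identityʳ (x zero))
idMat-*ᵥ {suc n} x (suc i) = idMat-*ᵥ (λ k → x (suc k)) i

idMat-sym : ∀ {n} (i j : Fin n) → idMat i j ≡ idMat j i
idMat-sym zero    zero    = refl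
idMat-sym zero    (suc j) = refl
idMat-sym (suc i) zero    = refl
idMat-sym (suc i) (suc j) = idMat-sym i j

*ᵥ-column-idMat : ∀ {n} (P : Mat n) j → P *ᵥ column idMat j ≗ column P j
*ᵥ-column-idMat P j i = begin
  (sum λ k → P i k ∧ idMat k j)
    ≡⟨ sum-cong-≗ (λ k → trans (∧-comm (P i k) _) (cong (_∧ P i k) (idMat-sym k j))) ⟩
  (sum λ k → idMat j k ∧ P i k)
    ≡⟨ idMat-*ᵥ (λ k → P i k) j ⟩
  P i j
    ∎

*ᵥ-inverse : ∀ {n} {P Q : Mat n} → (∀ i j → (Q ⊗ P) i j ≡ idMat i j) →
             ∀ x → Q *ᵥ P *ᵥ x ≗ x
*ᵥ-inverse {P = P} {Q} QP≡I x i = begin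
  (Q *ᵥ P *ᵥ x) i   ≡⟨ ⊗-*ᵥ Q P x i ⟨
  ((Q ⊗ P) *ᵥ x) i  ≡⟨ *ᵥ-congʳ QP≡I x i ⟩
  (idMat *ᵥ x) i    ≡⟨ idMat-*ᵥ x i ⟩
  x i               ∎

IsBijectionᵥ : ∀ {n} → Mat n → Set
IsBijectionᵥ P = Injective _≗_ _≗_ (P *ᵥ_) × StrictlySurjective _≗_ (P *ᵥ_)

invertible⇔bijectionᵥ : ∀ {n} (P : Mat n) → InvertibleZ2 P ⇔ IsBijectionᵥ P
invertible⇔bijectionᵥ {n} P = mk⇔ to from
  where
  to : InvertibleZ2 P → IsBijectionᵥ P
  to (Q , PQ≡I , QP≡I) = injective , λ v → Q *ᵥ v , *ᵥ-inverse PQ≡I v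
    where
    injective : Injective _≗_ _≗_ (P *ᵥ_)
    injective {x} {y} Px≗Py i = begin
      x i              ≡⟨ *ᵥ-inverse QP≡I x i ⟨
      (Q *ᵥ P *ᵥ x) i  ≡⟨ *ᵥ-congˡ Q Px≗Py i ⟩
      (Q *ᵥ P *ᵥ y) i  ≡⟨ *ᵥ-inverse QP≡I y i ⟩
      y i              ∎

  from : IsBijectionᵥ P → InvertibleZ2 P
  from (injective , surjective) = Q , PQ≡I , QP≡I
    where
    Q : Mat n
    Q i j = proj₁ (surjective (column idMat j)) i

    PQ≡I : ∀ i j → (P ⊗ Q) i j ≡ idMat i j
    PQ≡I i j = trans (column-⊗ P Q j i) (proj₂ (surjective (column idMat j)) i)

    QP≡I : ∀ i j → (Q ⊗ P) i j ≡ idMat i j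
    QP≡I i j = injective (λ k → begin
      (P *ᵥ column (Q ⊗ P) j) k  ≡⟨ *ᵥ-congˡ P (column-⊗ Q P j) k ⟩
      (P *ᵥ Q *ᵥ column P j) k   ≡⟨ *ᵥ-inverse PQ≡I (column P j) k ⟩
      P k j                      ≡⟨ *ᵥ-column-idMat P j k ⟨
      (P *ᵥ column idMat j) k    ∎) i

firstRow : ∀ {n} → Steinhaus n → Vector Bool n
firstRow t ℓ = entry t 0 (toℕ ℓ)

∑-binomMod2-zero : ∀ {n} j → j < n → (g : ℕ → Bool) →
  (sum λ (ℓ : Fin n) → binomMod2 0 (toℕ ℓ) j ∧ g (toℕ ℓ)) ≡ g j
∑-binomMod2-zero {suc n} zero    _         g =
  trans (cong (g 0 xor_) (sum-replicate-zero n)) (xor-identityʳ (g 0))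
∑-binomMod2-zero {suc n} (suc j) (s≤s j<n) g =
  ∑-binomMod2-zero j j<n (λ m → g (suc m))

entry≡binomial-sum : ∀ {n} (t : Steinhaus n) i j → i + j < n →
  entry t i j ≡ sum λ ℓ → binomMod2 i (toℕ ℓ) j ∧ firstRow t ℓ
entry≡binomial-sum t zero j j<n = sym (∑-binomMod2-zero j j<n (entry t 0))
entry≡binomial-sum {n} t (suc i) j 1+i+j<n = begin
  entry t (suc i) j
    ≡⟨ rule t i j 1+i+j<n ⟩
  entry t i j xor entry t i (suc j)
    ≡⟨ cong₂ _xor_ (entry≡binomial-sum t i j i+j<n) (entry≡binomial-sum t i (suc j) i+1+j<n) ⟩
  (sum λ ℓ → b j ℓ ∧ r ℓ) xor (sum λ ℓ → b (suc j) ℓ ∧ r ℓ)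
    ≡⟨ ∑-distrib-+ (λ ℓ → b j ℓ ∧ r ℓ) (λ ℓ → b (suc j) ℓ ∧ r ℓ) ⟨
  (sum λ ℓ → (b j ℓ ∧ r ℓ) xor (b (suc j) ℓ ∧ r ℓ))
    ≡⟨ sum-cong-≗ (λ ℓ → ∧-distribʳ-xor (r ℓ) (b j ℓ) (b (suc j) ℓ)) ⟨
  (sum λ ℓ → (b j ℓ xor b (suc j) ℓ) ∧ r ℓ)
    ≡⟨ sum-cong-≗ (λ ℓ → cong (_∧ r ℓ) (binomMod2-pascal i (toℕ ℓ) j)) ⟨
  (sum λ ℓ → binomMod2 (suc i) (toℕ ℓ) j ∧ r ℓ)
    ∎
  where
  r : Vector Bool n
  r = firstRow t
  b : ℕ → Fin n → Bool
  b j′ ℓ = binomMod2 i (toℕ ℓ) j′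
  i+j<n : i + j < n
  i+j<n = <-trans (n<1+n (i + j)) 1+i+j<n
  i+1+j<n : i + suc j < n
  i+1+j<n = subst (_< n) (sym (+-suc i j)) 1+i+j<n

π≗M*ᵥfirstRow : ∀ {n} (A : Fin n → ℕ × ℕ) → (∀ k → InT n (A k)) →
  ∀ t → π A t ≗ M_ A *ᵥ firstRow t
π≗M*ᵥfirstRow A A⊆T t k = entry≡binomial-sum t (proj₁ (A k)) (proj₂ (A k)) (A⊆T k)

firstRow-injective : ∀ {n} (s t : Steinhaus n) → firstRow s ≗ firstRow t → s ≈ST t
firstRow-injective s t rows≗ i j i+j<n = begin
  entry s i j
    ≡⟨ entry≡binomial-sum s i j i+j<n ⟩
  (sum λ ℓ → binomMod2 i (toℕ ℓ) j ∧ firstRow s ℓ)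
    ≡⟨ sum-cong-≗ (λ ℓ → cong (binomMod2 i (toℕ ℓ) j ∧_) (rows≗ ℓ)) ⟩
  (sum λ ℓ → binomMod2 i (toℕ ℓ) j ∧ firstRow t ℓ)
    ≡⟨ entry≡binomial-sum t i j i+j<n ⟨
  entry t i j
    ∎

lookupOr : ∀ {a} {A : Set a} {n} → A → Vector A n → ℕ → A
lookupOr {n = zero}  d r _       = d
lookupOr {n = suc n} d r zero    = r zero
lookupOr {n = suc n} d r (suc j) = lookupOr d (λ i → r (suc i)) j

lookupOr-toℕ : ∀ {a} {A : Set a} {n} (d : A) (r : Vector A n) ℓ →
               lookupOr d r (toℕ ℓ) ≡ r ℓ
lookupOr-toℕ d r zero    = refl
lookupOr-toℕ d r (suc ℓ) = lookupOr-toℕ d (λ i → r (suc i)) ℓ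

xorTriangle : (ℕ → Bool) → ℕ → ℕ → Bool
xorTriangle r zero    j = r j
xorTriangle r (suc i) j = xorTriangle r i j xor xorTriangle r i (suc j)

fromFirstRow : ∀ {n} → Vector Bool n → Steinhaus n
fromFirstRow r = record
  { entry = xorTriangle (lookupOr false r)
  ; rule  = λ _ _ _ → refl
  }

firstRow-fromFirstRow : ∀ {n} (r : Vector Bool n) → firstRow (fromFirstRow r) ≗ r
firstRow-fromFirstRow r = lookupOr-toℕ false r

generating⇔bijectionᵥ : ∀ {n} (A : Fin n → ℕ × ℕ) → (∀ k → InT n (A k)) →
  IsGeneratingIndexSet n A ⇔ IsBijectionᵥ (M_ A)
generating⇔bijectionᵥ {n} A A⊆T = mk⇔ to from
  where
  π-factor : ∀ t → π A t ≗ M_ A *ᵥ firstRow t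
  π-factor = π≗M*ᵥfirstRow A A⊆T

  π-fromFirstRow : ∀ x → π A (fromFirstRow x) ≗ M_ A *ᵥ x
  π-fromFirstRow x k =
    trans (π-factor (fromFirstRow x) k) (*ᵥ-congˡ (M_ A) (firstRow-fromFirstRow x) k)

  to : IsGeneratingIndexSet n A → IsBijectionᵥ (M_ A)
  to (π-injective , π-surjective) = injective , surjective
    where
    injective : Injective _≗_ _≗_ (M_ A *ᵥ_)
    injective {x} {y} Mx≗My ℓ = begin
      x ℓ
        ≡⟨ firstRow-fromFirstRow x ℓ ⟨
      firstRow (fromFirstRow x) ℓ
        ≡⟨ π-injective (fromFirstRow x) (fromFirstRow y) πx≗πy 0 (toℕ ℓ) (toℕ<n ℓ) ⟩
      firstRow (fromFirstRow y) ℓ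
        ≡⟨ firstRow-fromFirstRow y ℓ ⟩
      y ℓ
        ∎
      where
      πx≗πy : π A (fromFirstRow x) ≗ π A (fromFirstRow y)
      πx≗πy k = trans (π-fromFirstRow x k) (trans (Mx≗My k) (sym (π-fromFirstRow y k)))

    surjective : StrictlySurjective _≗_ (M_ A *ᵥ_)
    surjective v with π-surjective v
    ... | t , πt≗v = firstRow t , λ k → trans (sym (π-factor t k)) (πt≗v k)

  from : IsBijectionᵥ (M_ A) → IsGeneratingIndexSet n A
  from (injective , surjective) = π-injective , π-surjective
    where
    π-injective : ∀ s t → (∀ k → π A s k ≡ π A t k) → s ≈ST t
    π-injective s t πs≗πt = firstRow-injective s t (injective λ k →
      trans (sym (π-factor s k)) (trans (πs≗πt k) (π-factor t k)))

    π-surjective : ∀ v → Σ (Steinhaus n) λ t → ∀ k → π A t k ≡ v k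
    π-surjective v with surjective v
    ... | x , Mx≗v = fromFirstRow x , λ k → trans (π-fromFirstRow x k) (Mx≗v k)

proposition3 : (n : ℕ) (A : Fin n → ℕ × ℕ) →
    (∀ k → InT n (A k)) → Injective _≡_ _≡_ A →
    IsGeneratingIndexSet n A ⇔ InvertibleZ2 (M_ A)
proposition3 n A A⊆T _ =
  ⇔-sym (invertible⇔bijectionᵥ (M_ A)) ⇔-∘ generating⇔bijectionᵥ A A⊆T
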